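{- Let $m\ge 2$ and let $G_{m,4}=S_m\Box P_4$ be the stacked-book graph with factor stars $S_m(1),S_m(2),S_m(3),S_m(4)$, where the vertices of $S_m(2)$ are $u_1,\dots,u_m$ and those of $S_m(3)$ are $w_1,\dots,w_m$ (with $u_1,w_1$ the central vertices and $u_iw_i$ an edge for each $i$). Suppose $im(G_{m,4})\ge m$, and let $M$ be a maximum induced matching of $G_{m,4}$. Then $M'=\{u_iw_i : i\in[2,m]\}$ is not a subset of $M$.
   Context: $S_m$ is the star graph with one central vertex and $m-1$ leaves. The stacked-book graph $G_{m,n}=S_m\Box P_n$ consists of $n$ copies $S_m(1),\dots,S_m(n)$ of $S_m$, with each vertex of $S_m(i)$ joined to the corresponding vertex of $S_m(i+1)$ for $i\in[1,n-1]$. An induced matching of a graph $G$ is a set $M$ of edges such that no two edges of $M$ share an endpoint and no edge of $G$ joins an endpoint of one edge of $M$ to an endpoint of another edge of $M$; $im(G)$ is the maximum size of an induced matching of $G$. -}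

module Defs where

open import Data.Nat using (ℕ; zero; suc; _≤_)
open import Data.Fin using (Fin; toℕ)
open import Data.Product using (_×_; _,_; proj₁; proj₂; ∃)
open import Data.Sum using (_⊎_)
open import Data.List using (List; length; lookup)
open import Data.List.Relation.Unary.All using (All)
open import Relation.Binary.PropositionalEquality using (_≡_; _≢_)
open import Relation.Nullary using (¬_)

-- Vertices of G_{m,n} = S_m □ P_n : (star vertex a, layer i).
-- Star vertex index 0 (toℕ a ≡ 0) is the centre of S_m; the others are the m-1 leaves.
-- Layer index i : Fin n is the copy S_m(i+1).
Vtx : ℕ → ℕ → Set
Vtx m n = Fin m × Fin n

StarAdj : {m : ℕ} → Fin m → Fin m → Set
StarAdj a b = (toℕ a ≡ 0 × toℕ b ≢ 0) ⊎ (toℕ a ≢ 0 × toℕ b ≡ 0)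

PathAdj : {n : ℕ} → Fin n → Fin n → Set
PathAdj i j = suc (toℕ i) ≡ toℕ j ⊎ suc (toℕ j) ≡ toℕ i

Adj : {m n : ℕ} → Vtx m n → Vtx m n → Set
Adj (a , i) (b , j) = (i ≡ j × StarAdj a b) ⊎ (a ≡ b × PathAdj i j)

Edge : ℕ → ℕ → Set
Edge m n = Vtx m n × Vtx m n

EndOf : {m n : ℕ} → Vtx m n → Edge m n → Set
EndOf x e = x ≡ proj₁ e ⊎ x ≡ proj₂ e

-- An induced matching: a list of edges of G_{m,n} such that any two edges at
-- distinct positions have pairwise distinct and pairwise non-adjacent endpoints.
-- (This forces the listed edges to be distinct, so length = size of the set.)
IsInducedMatching : (m n : ℕ) → List (Edge m n) → Set
IsInducedMatching m n M =
  All (λ e → Adj (proj₁ e) (proj₂ e)) M ×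
  ((p q : Fin (length M)) → p ≢ q →
     (x y : Vtx m n) → EndOf x (lookup M p) → EndOf y (lookup M q) →
     x ≢ y × ¬ Adj x y)

ImAtLeast : (m n k : ℕ) → Set
ImAtLeast m n k = ∃ λ (M : List (Edge m n)) → IsInducedMatching m n M × k ≤ length M

IsMaxInducedMatching : (m n : ℕ) → List (Edge m n) → Set
IsMaxInducedMatching m n M =
  IsInducedMatching m n M ×
  ((M' : List (Edge m n)) → IsInducedMatching m n M' → length M' ≤ length M)

EdgeIn : {m n : ℕ} → Vtx m n → Vtx m n → List (Edge m n) → Set
EdgeIn {m} {n} x y M =
  ∃ λ (p : Fin (length M)) → lookup M p ≡ (x , y) ⊎ lookup M p ≡ (y , x)

module Submission where

open import Defs
open import Data.Nat using (ℕ; suc; _≤_; s≤s)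
open import Data.Nat.Properties using (≤-trans; ≤⇒≯)
open import Data.Fin using (Fin; toℕ; zero; suc; _≟_)
open import Data.Fin.Properties using (injective⇒≤)
open import Data.Product using (_×_; _,_; proj₁; proj₂; ∃; ∃₂)
open import Data.Sum using (_⊎_; inj₁; inj₂)
open import Data.Empty using (⊥-elim)
open import Data.List using (List; length; lookup)
import Data.List.Relation.Unary.All as All
open import Data.List.Membership.Propositional.Properties using (∈-lookup)
open import Relation.Binary.PropositionalEquality using (_≡_; refl; sym; trans; _≢_; cong)
open import Relation.Nullary using (¬_; yes; no)

-- If M contains every rung u_i w_i with i ≥ 2, then every vertex except the centres of S_m(1)
-- and S_m(4) is equal or adjacent to an endpoint of such a rung, and those two centres are not
-- adjacent. So every edge of M touches one of the m - 1 rungs; in an induced matching an edge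
-- touching another edge is that edge, hence |M| ≤ m - 1 < m ≤ im(G_{m,4}) = |M|.

Near : ∀ {m n} → Vtx m n → Vtx m n → Set
Near x y = x ≡ y ⊎ Adj x y

EdgesTouch : ∀ {m n} → Edge m n → Edge m n → Set
EdgesTouch e f = ∃₂ λ x y → EndOf x e × EndOf y f × Near x y

module InducedMatching {m n} {M : List (Edge m n)} (im : IsInducedMatching m n M) where

  isEdge : (p : Fin (length M)) → Adj (proj₁ (lookup M p)) (proj₂ (lookup M p))
  isEdge p = All.lookup (proj₁ im) (∈-lookup p)

  touching⇒samePosition : (p q : Fin (length M)) →
    EdgesTouch (lookup M p) (lookup M q) → p ≡ q
  touching⇒samePosition p q (x , y , x∈p , y∈q , x~y) with p ≟ q
  ... | yes p≡q = p≡q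
  ... | no  p≢q with proj₂ im p q p≢q x y x∈p y∈q | x~y
  ...   | x≢y , _    | inj₁ x≡y   = ⊥-elim (x≢y x≡y)
  ...   | _   , ¬x~y | inj₂ x-adj = ⊥-elim (¬x~y x-adj)

  length≤-ifTouchedBy : ∀ {k} (pos : Fin k → Fin (length M)) →
    ((p : Fin (length M)) → ∃ λ j → EdgesTouch (lookup M p) (lookup M (pos j))) →
    length M ≤ k
  length≤-ifTouchedBy pos touched = injective⇒≤ {f = λ p → proj₁ (touched p)} injective
    where
    pos-touched : ∀ p → pos (proj₁ (touched p)) ≡ p
    pos-touched p = sym (touching⇒samePosition p _ (proj₂ (touched p)))

    injective : ∀ {p q} → proj₁ (touched p) ≡ proj₁ (touched q) → p ≡ q
    injective {p} {q} eq =
      trans (sym (pos-touched p)) (trans (cong pos eq) (pos-touched q))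

endOf-swap : ∀ {m n} {x : Vtx m n} {a b e} →
  e ≡ (a , b) ⊎ e ≡ (b , a) → EndOf x (a , b) → EndOf x e
endOf-swap (inj₁ refl) x∈ab        = x∈ab
endOf-swap (inj₂ refl) (inj₁ x≡a) = inj₂ x≡a
endOf-swap (inj₂ refl) (inj₂ x≡b) = inj₁ x≡b

¬starAdj-centres : ∀ {m} {c : Fin m} → toℕ c ≡ 0 → ¬ StarAdj c c
¬starAdj-centres c≡0 (inj₁ (_ , c≢0)) = c≢0 c≡0
¬starAdj-centres c≡0 (inj₂ (c≢0 , _)) = c≢0 c≡0

adjCopies⇒pathAdj : ∀ {m n} {a : Fin m} {i j : Fin n} → toℕ a ≡ 0 →
  Adj (a , i) (a , j) → PathAdj i j
adjCopies⇒pathAdj a≡0 (inj₁ (_ , a~a)) = ⊥-elim (¬starAdj-centres a≡0 a~a)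
adjCopies⇒pathAdj _   (inj₂ (_ , i~j)) = i~j

OuterLayer : Fin 4 → Set
OuterLayer i = i ≡ zero ⊎ i ≡ suc (suc (suc zero))

¬pathAdj-outer : ∀ {i j} → OuterLayer i → OuterLayer j → ¬ PathAdj i j
¬pathAdj-outer (inj₁ refl) (inj₁ refl) (inj₁ ())
¬pathAdj-outer (inj₁ refl) (inj₁ refl) (inj₂ ())
¬pathAdj-outer (inj₁ refl) (inj₂ refl) (inj₁ ())
¬pathAdj-outer (inj₁ refl) (inj₂ refl) (inj₂ ())
¬pathAdj-outer (inj₂ refl) (inj₁ refl) (inj₁ ())
¬pathAdj-outer (inj₂ refl) (inj₁ refl) (inj₂ ())
¬pathAdj-outer (inj₂ refl) (inj₂ refl) (inj₁ ())
¬pathAdj-outer (inj₂ refl) (inj₂ refl) (inj₂ ())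

module StackedBook₄ (k : ℕ) where

  V : Set
  V = Vtx (suc (suc k)) 4

  u w : Fin (suc k) → V
  u j = suc j , suc zero
  w j = suc j , suc (suc zero)

  OuterCentre : V → Set
  OuterCentre v = ∃ λ i → OuterLayer i × v ≡ (zero , i)

  NearRung : V → Set
  NearRung v = ∃₂ λ j y → EndOf y (u j , w j) × Near v y

  nearRung⊎outerCentre : (v : V) → NearRung v ⊎ OuterCentre v
  nearRung⊎outerCentre (zero , zero)                   = inj₂ (_ , inj₁ refl , refl)
  nearRung⊎outerCentre (zero , suc zero)               =
    inj₁ (zero , _ , inj₁ refl , inj₂ (inj₁ (refl , inj₁ (refl , λ ()))))
  nearRung⊎outerCentre (zero , suc (suc zero))         =
    inj₁ (zero , _ , inj₂ refl , inj₂ (inj₁ (refl , inj₁ (refl , λ ()))))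
  nearRung⊎outerCentre (zero , suc (suc (suc zero)))   = inj₂ (_ , inj₂ refl , refl)
  nearRung⊎outerCentre (suc j , zero)                  =
    inj₁ (j , _ , inj₁ refl , inj₂ (inj₂ (refl , inj₁ refl)))
  nearRung⊎outerCentre (suc j , suc zero)              = inj₁ (j , _ , inj₁ refl , inj₁ refl)
  nearRung⊎outerCentre (suc j , suc (suc zero))        = inj₁ (j , _ , inj₂ refl , inj₁ refl)
  nearRung⊎outerCentre (suc j , suc (suc (suc zero)))  =
    inj₁ (j , _ , inj₂ refl , inj₂ (inj₂ (refl , inj₂ refl)))

  ¬adj-outerCentres : ∀ {x y} → OuterCentre x → OuterCentre y → ¬ Adj x y
  ¬adj-outerCentres (_ , i-outer , refl) (_ , j-outer , refl) x~y =
    ¬pathAdj-outer i-outer j-outer (adjCopies⇒pathAdj refl x~y)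

  edge-nearRung : ∀ {x y} → Adj x y → NearRung x ⊎ NearRung y
  edge-nearRung {x} {y} x~y with nearRung⊎outerCentre x | nearRung⊎outerCentre y
  ... | inj₁ x-near | _           = inj₁ x-near
  ... | inj₂ _      | inj₁ y-near = inj₂ y-near
  ... | inj₂ x-out  | inj₂ y-out  = ⊥-elim (¬adj-outerCentres x-out y-out x~y)

  length≤-ifRungsIn : (M : List (Edge (suc (suc k)) 4)) → IsInducedMatching (suc (suc k)) 4 M →
    ((i : Fin (suc (suc k))) → toℕ i ≢ 0 → EdgeIn (i , suc zero) (i , suc (suc zero)) M) →
    length M ≤ suc k
  length≤-ifRungsIn M im rungsIn = length≤-ifTouchedBy pos touchesRung
    where
    open InducedMatching im

    pos : Fin (suc k) → Fin (length M)
    pos j = proj₁ (rungsIn (suc j) λ ())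

    rungEnd : ∀ {j y} → EndOf y (u j , w j) → EndOf y (lookup M (pos j))
    rungEnd {j} = endOf-swap (proj₂ (rungsIn (suc j) λ ()))

    touchesRung : (p : Fin (length M)) → ∃ λ j → EdgesTouch (lookup M p) (lookup M (pos j))
    touchesRung p with edge-nearRung (isEdge p)
    ... | inj₁ (j , y , y∈rung , x~y) = j , _ , y , inj₁ refl , rungEnd y∈rung , x~y
    ... | inj₂ (j , y , y∈rung , x~y) = j , _ , y , inj₂ refl , rungEnd y∈rung , x~y

lemma4 : (m : ℕ) → 2 ≤ m → ImAtLeast m 4 m →
    (M : List (Edge m 4)) → IsMaxInducedMatching m 4 M →
    ¬ ((i : Fin m) → toℕ i ≢ 0 → EdgeIn (i , suc zero) (i , suc (suc zero)) M)
lemma4 (suc (suc k)) _ (M₀ , im₀ , m≤|M₀|) M (im , maximum) rungsIn =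
  ≤⇒≯ (StackedBook₄.length≤-ifRungsIn k M im rungsIn) m≤|M|
  where
  m≤|M| : suc (suc k) ≤ length M
  m≤|M| = ≤-trans m≤|M₀| (maximum M₀ im₀)
lemma4 1 (s≤s ())
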